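{- Let $\mathbf{L}$ be a De Morgan semi-Heyting algebra of level $1$, and let $x\in L$. Then $(x^*)' \land x' \land x^* = 0$.
   Context: A semi-Heyting algebra is an algebra $\langle L,\vee,\wedge,\to,0,1\rangle$ such that $\langle L,\vee,\wedge,0,1\rangle$ is a bounded lattice and the identities $x\wedge(x\to y)\approx x\wedge y$, $x\wedge(y\to z)\approx x\wedge[(x\wedge y)\to(x\wedge z)]$, and $x\to x\approx 1$ hold; $x^* := x\to 0$ is the pseudocomplement. A dually quasi-De Morgan semi-Heyting algebra ($\mathbf{DQD}$-algebra) is an algebra $\langle L,\vee,\wedge,\to,{}',0,1\rangle$ whose reduct $\langle L,\vee,\wedge,\to,0,1\rangle$ is a semi-Heyting algebra and which satisfies $0'\approx 1$, $1'\approx 0$, $(x\wedge y)'\approx x'\vee y'$, $(x\vee y)''\approx x''\vee y''$, and $x''\le x$. A De Morgan semi-Heyting algebra is a $\mathbf{DQD}$-algebra satisfying $x''\approx x$. Define $x^{0('^*)} := x$, $x^{(k+1)('^*)} := ((x^{k('^*)})')^*$, $t_0(x):=x$, $t_{k+1}(x):=t_k(x)\wedge x^{(k+1)('^*)}$. The algebra is of level $1$ if it satisfies $t_1(x)\approx t_2(x)$, i.e. $x\wedge (x')^* \approx x\wedge (x')^*\wedge ((x')^{*})'^{*}$ where $((x')^*)'^* = (((x')^*)')^*$. -}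

module Defs where

open import Level using (Level; suc; _⊔_)
open import Relation.Binary.PropositionalEquality using (_≡_)
open import Algebra.Lattice.Structures using (IsLattice)
open import Data.Nat using (ℕ; zero) renaming (suc to sucℕ)

-- A DQD-algebra (dually quasi-De Morgan semi-Heyting algebra), on a carrier
-- with propositional equality.  Order: x ≤ y iff x ∧ y ≡ x.
record DQDAlgebra (c : Level) : Set (suc c) where
  infixr 5 _⇒_
  infixr 7 _∧_
  infixr 6 _∨_
  field
    Carrier : Set c
    _∨_ _∧_ _⇒_ : Carrier → Carrier → Carrier
    ′_ : Carrier → Carrier
    𝟘 𝟙 : Carrier
    isLattice : IsLattice _≡_ _∨_ _∧_
    ∧-zeroʳ : ∀ x → x ∧ 𝟘 ≡ 𝟘
    ∨-identityʳ : ∀ x → x ∨ 𝟘 ≡ x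
    ∧-identityʳ : ∀ x → x ∧ 𝟙 ≡ x
    ∨-zeroʳ : ∀ x → x ∨ 𝟙 ≡ 𝟙
    sh1 : ∀ x y → x ∧ (x ⇒ y) ≡ x ∧ y
    sh2 : ∀ x y z → x ∧ (y ⇒ z) ≡ x ∧ ((x ∧ y) ⇒ (x ∧ z))
    sh3 : ∀ x → x ⇒ x ≡ 𝟙
    dq1 : ′ 𝟘 ≡ 𝟙
    dq2 : ′ 𝟙 ≡ 𝟘
    dq3 : ∀ x y → ′ (x ∧ y) ≡ (′ x) ∨ (′ y)
    dq4 : ∀ x y → ′ ′ (x ∨ y) ≡ (′ ′ x) ∨ (′ ′ y)
    dq5 : ∀ x → (′ ′ x) ∧ x ≡ ′ ′ x

  _* : Carrier → Carrier
  x * = x ⇒ 𝟘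

  iter′* : Carrier → (k : ℕ) → Carrier
  iter′* x zero = x
  iter′* x (sucℕ k) = (′ (iter′* x k)) *

  t : (k : ℕ) → Carrier → Carrier
  t zero x = x
  t (sucℕ k) x = t k x ∧ iter′* x (sucℕ k)


IsDeMorgan : ∀ {c} → DQDAlgebra c → Set c
IsDeMorgan A = ∀ x → ′ ′ x ≡ x
  where open DQDAlgebra A

IsLevel1 : ∀ {c} → DQDAlgebra c → Set c
IsLevel1 A = ∀ x → t 1 x ≡ t 2 x
  where open DQDAlgebra A

module Submission where

-- Proof idea.  Write a = (x*)' and y = x' ∧ x*.  The claim is a ∧ y = 0.
--
--   * In any semi-Heyting algebra z ∧ z* = z ∧ 0 = 0 (axiom x ∧ (x → y) = x ∧ y),
--     hence every element below z* is disjoint from z.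
--   * Level 1 instantiated at x' says  x' ∧ (x'')* ≤ ((x'')*)'*; in a De Morgan
--     algebra x'' = x, so  y = x' ∧ x* ≤ ((x*)')* = a*.
--   * Therefore a ∧ y = 0, which is the theorem after reassociating the meets.

open import Defs
open import Relation.Binary.PropositionalEquality
  using (_≡_; sym; cong; subst; module ≡-Reasoning)
open import Algebra.Lattice.Structures using (IsLattice)

module _ {c} (A : DQDAlgebra c) where
  open DQDAlgebra A
  open IsLattice isLattice using (∧-assoc; ∧-comm)
  open ≡-Reasoning

  ∧-pseudocomplement : ∀ z → z ∧ z * ≡ 𝟘
  ∧-pseudocomplement z = begin
    z ∧ (z ⇒ 𝟘) ≡⟨ sh1 z 𝟘 ⟩
    z ∧ 𝟘       ≡⟨ ∧-zeroʳ z ⟩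
    𝟘           ∎

  below-pseudocomplement-disjoint : ∀ y z → y ≡ y ∧ z * → z ∧ y ≡ 𝟘
  below-pseudocomplement-disjoint y z y≤z* = begin
    z ∧ y             ≡⟨ cong (z ∧_) y≤z* ⟩
    z ∧ (y ∧ z *)     ≡⟨ cong (z ∧_) (∧-comm y (z *)) ⟩
    z ∧ (z * ∧ y)     ≡⟨ sym (∧-assoc z (z *) y) ⟩
    (z ∧ z *) ∧ y     ≡⟨ cong (_∧ y) (∧-pseudocomplement z) ⟩
    𝟘 ∧ y             ≡⟨ ∧-comm 𝟘 y ⟩
    y ∧ 𝟘             ≡⟨ ∧-zeroʳ y ⟩
    𝟘                 ∎

  -- Level 1 at the element x', rewritten with x'' = x:
  -- x' ∧ x* lies below ((x*)')*.
  level1-at-negation : IsDeMorgan A → IsLevel1 A →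
    ∀ x → ′ x ∧ x * ≡ (′ x ∧ x *) ∧ (′ (x *)) *
  level1-at-negation deMorgan level1 x =
    subst (λ z → ′ x ∧ z * ≡ (′ x ∧ z *) ∧ (′ (z *)) *) (deMorgan x) (level1 (′ x))

lemma3p2 : ∀ {c} (A : DQDAlgebra c) → IsDeMorgan A → IsLevel1 A →
    ∀ x → DQDAlgebra._∧_ A (DQDAlgebra._∧_ A (DQDAlgebra.′_ A (DQDAlgebra._* A x)) (DQDAlgebra.′_ A x)) (DQDAlgebra._* A x) ≡ DQDAlgebra.𝟘 A
lemma3p2 A deMorgan level1 x = begin
    (′ (x *) ∧ ′ x) ∧ x *   ≡⟨ ∧-assoc (′ (x *)) (′ x) (x *) ⟩
    ′ (x *) ∧ (′ x ∧ x *)   ≡⟨ below-pseudocomplement-disjoint A (′ x ∧ x *) (′ (x *))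
                                 (level1-at-negation A deMorgan level1 x) ⟩
    𝟘                       ∎
  where
  open DQDAlgebra A
  open IsLattice isLattice using (∧-assoc)
  open ≡-Reasoning
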